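{- Fix a set $\mathsf{Atoms}$ of atomic propositions, a set $\mathsf{Compounds}\supseteq\mathsf{Atoms}$ of compound propositions, and a family $B$ of bonding functions. Let $M$ be a set of computations (infinite sequences over $\mathcal{P}(\mathsf{Atoms})$) that is recognized by some Büchi automaton. Let $\phi$ be a $\text{HyperLTL}_2$ formula of the form $\mathrm{A}^k\mathrm{E}^j\psi$ (a block of $k$ universal path quantifiers followed by a block of $j$ existential path quantifiers, followed by a quantifier-free body $\psi$), and let $n=k+j$. Let $A^n_M$ be a Büchi automaton over the alphabet $\mathcal{P}(\mathsf{Atoms})^n$ with $\mathcal{L}(A^n_M)=\{\mathit{zip}(\gamma_1,\dots,\gamma_n)\mid \gamma_1,\dots,\gamma_n\in M\}$, let $A^k_M$ be a Büchi automaton over $\mathcal{P}(\mathsf{Atoms})^k$ with $\mathcal{L}(A^k_M)=\{\mathit{zip}(\gamma_1,\dots,\gamma_k)\mid \gamma_1,\dots,\gamma_k\in M\}$, and let $A_\psi$ be a Büchi automaton over $\mathcal{P}(\mathsf{Atoms})^n$ whose language is the set of all infinite words $w$ with $\mathit{unzip}(w)\models\psi$. Then $\phi$ holds of $M$ (i.e., the empty tuple of computations satisfies $\phi$ with respect to model $M$ and bonding functions $B$) if and only if $\mathcal{L}\big(((A^n_M\cap A_\psi)|_k)^C\cap A^k_M\big)=\emptyset$.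
   Context: HyperLTL syntax: $\phi ::= \mathrm{A}\phi \mid \mathrm{E}\phi \mid \psi$ and $\psi ::= p \mid \neg\psi \mid \psi\vee\psi \mid \langle\psi,\dots,\psi\rangle \mid \mathrm{X}\psi \mid \psi\,\mathrm{U}\,\psi$, with $\wedge,\rightarrow,\leftrightarrow,\top,\bot$, $\mathrm{F}\psi=\top\,\mathrm{U}\,\psi$, $\mathrm{G}\psi=\neg\mathrm{F}\neg\psi$, $\psi_1\mathrm{R}\psi_2=\neg(\neg\psi_1\mathrm{U}\neg\psi_2)$ as abbreviations. A formula is well-formed if it has at least one path quantifier and every focus subformula $\langle\psi_1,\dots,\psi_m\rangle$ has $m$ equal to the number of leading path quantifiers. $\text{HyperLTL}_2$ is the fragment of well-formed formulas whose quantifier prefix has at most one alternation (a block of A's followed by a block of E's or vice versa) and in which every component $\psi_i$ of a focus formula is propositional (contains no X or U). Semantics: a computation $\gamma$ is an infinite sequence over $\mathcal{P}(\mathsf{Atoms})$, indexed from 1; $\gamma[i]$ is its $i$-th element and $\gamma[i..]$ its suffix from position $i$. For a finite tuple $\Gamma=(\gamma_1,\dots,\gamma_m)$, $\mathit{prj}_i(\Gamma)=\gamma_i$, $\Gamma\cdot\gamma=(\gamma_1,\dots,\gamma_m,\gamma)$, $\Gamma[i]=(\gamma_1[i],\dots,\gamma_m[i])$, $\Gamma[i..]=(\gamma_1[i..],\dots,\gamma_m[i..])$. A family of bonding functions is $B=\{B_i\}_{i\in\mathbb{N}}$ with $B_i:\mathcal{P}(\mathsf{Atoms})^i\to\mathcal{P}(\mathsf{Compounds})$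 and $B_1$ the identity; $B$ applied to an $i$-tuple means $B_i$. Given a model $M$ (set of computations) and $B$: $\Gamma\models\mathrm{A}\psi$ iff $\Gamma\cdot\gamma\models\psi$ for all $\gamma\in M$; $\Gamma\models\mathrm{E}\psi$ iff $\Gamma\cdot\gamma\models\psi$ for some $\gamma\in M$; $\Gamma\models p$ iff $p\in B(\Gamma[1])$; $\Gamma\models\neg\psi$ iff $\Gamma\not\models\psi$; $\Gamma\models\psi_1\vee\psi_2$ iff $\Gamma\models\psi_1$ or $\Gamma\models\psi_2$; $\Gamma\models\langle\psi_1,\dots,\psi_m\rangle$ iff $\mathit{prj}_i(\Gamma)\models\psi_i$ for all $1\le i\le m$; $\Gamma\models\mathrm{X}\psi$ iff $\Gamma[2..]\models\psi$; $\Gamma\models\psi_1\mathrm{U}\psi_2$ iff there is $k\ge1$ with $\Gamma[k..]\models\psi_2$ and $\Gamma[j..]\models\psi_1$ for all $1\le j<k$. $\mathit{zip}$ maps an $n$-tuple of infinite sequences to the infinite sequence of $n$-tuples (e.g. $\mathit{zip}([1,2,3],[4,5,6])=[(1,4),(2,5),(3,6)]$) and $\mathit{unzip}$ is its inverse. A Büchi automaton $(\Sigma,S,\Delta,S_0,F)$ accepts an infinite word if some run over it from an initial state visits $F$ infinitely often. $A\cap A'$ is an automaton recognizing $\mathcal{L}(A)\cap\mathcal{L}(A')$; $A^C$ is an automaton recognizing the complement of $\mathcal{L}(A)$ among all infinite words over its alphabet; for an automaton $A$ over alphabet $\mathcal{P}(\mathsf{Atoms})^n$, $A|_k$ is the automaton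 over $\mathcal{P}(\mathsf{Atoms})^k$ obtained by replacing every transition label (an $n$-tuple) by its first $k$ components, so that $\mathcal{L}(A|_k)$ consists of the first-$k$-component projections of words of $\mathcal{L}(A)$. -}

module Defs where

open import Level using (0ℓ)
open import Data.Nat using (ℕ; zero; suc; _+_; _≤_; _<_)
open import Data.Fin using (Fin)
open import Data.Fin.Subset using (Subset) renaming (_∈_ to _∈ₛ_)
open import Data.Vec using (Vec; []; _∷_; _∷ʳ_; map; take; tabulate; lookup)
open import Data.List using (List; []; _∷_; length)
import Data.List as L
open import Data.List.Membership.Propositional using () renaming (_∈_ to _∈ₗ_)
open import Data.Product using (Σ; _×_; _,_)
open import Data.Sum using (_⊎_)
open import Data.Unit using (⊤)
open import Data.Empty using (⊥)
open import Relation.Nullary using (¬_)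
open import Relation.Binary.PropositionalEquality using (_≡_)
open import Function.Bundles using (_⇔_)

-- Atoms = Fin na (a finite set of atomic propositions);
-- P(Atoms) = Subset na.  A computation is an infinite sequence over
-- P(Atoms), indexed from 0 here (position 0 = the paper's position 1).

Letter₁ : ℕ → Set
Letter₁ na = Subset na

Comp : ℕ → Set
Comp na = ℕ → Subset na

Letter : ℕ → ℕ → Set
Letter na n = Vec (Subset na) n

Word : Set → Set
Word Σ' = ℕ → Σ'

Bonding : ℕ → Set → Set₁
Bonding na Compounds = (i : ℕ) → Vec (Subset na) i → Compounds → Set

-- B_1 is the identity (Atoms ⊆ Compounds via the injection ι)
B₁-identity : ∀ {na} {Compounds : Set} → (Fin na → Compounds) → Bonding na Compounds → Set
B₁-identity {na} {Compounds} ι B =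
  ∀ (X : Subset na) (c : Compounds) →
    B 1 (X ∷ []) c ⇔ Σ (Fin na) (λ a → ι a ≡ c × a ∈ₛ X)

data Formula (Compounds : Set) : Set where
  A     : Formula Compounds → Formula Compounds
  E     : Formula Compounds → Formula Compounds
  atom  : Compounds → Formula Compounds
  neg   : Formula Compounds → Formula Compounds
  or    : Formula Compounds → Formula Compounds → Formula Compounds
  focus : List (Formula Compounds) → Formula Compounds
  X     : Formula Compounds → Formula Compounds
  U     : Formula Compounds → Formula Compounds → Formula Compounds

module _ {Compounds : Set} where

  Ablock : ℕ → Formula Compounds → Formula Compounds
  Ablock zero    ψ = ψ
  Ablock (suc k) ψ = A (Ablock k ψ)

  Eblock : ℕ → Formula Compounds → Formula Compounds
  Eblock zero    ψ = ψ
  Eblock (suc j) ψ = E (Eblock j ψ)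

  AE : ℕ → ℕ → Formula Compounds → Formula Compounds
  AE k j ψ = Ablock k (Eblock j ψ)

  data Quant : Set where
    qA qE : Quant

  prefixOf : Formula Compounds → List Quant
  prefixOf (A φ) = qA ∷ prefixOf φ
  prefixOf (E φ) = qE ∷ prefixOf φ
  prefixOf _     = []

  bodyOf : Formula Compounds → Formula Compounds
  bodyOf (A φ) = bodyOf φ
  bodyOf (E φ) = bodyOf φ
  bodyOf φ     = φ

  alternations : List Quant → ℕ
  alternations []                = 0
  alternations (q ∷ [])          = 0
  alternations (qA ∷ qA ∷ qs)    = alternations (qA ∷ qs)
  alternations (qE ∷ qE ∷ qs)    = alternations (qE ∷ qs)
  alternations (qA ∷ qE ∷ qs)    = suc (alternations (qE ∷ qs))
  alternations (qE ∷ qA ∷ qs)    = suc (alternations (qA ∷ qs))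

  mutual
    QFree : Formula Compounds → Set
    QFree (A φ)       = ⊥
    QFree (E φ)       = ⊥
    QFree (atom p)    = ⊤
    QFree (neg φ)     = QFree φ
    QFree (or φ φ₁)   = QFree φ × QFree φ₁
    QFree (focus ψs)  = QFreeL ψs
    QFree (X φ)       = QFree φ
    QFree (U φ φ₁)    = QFree φ × QFree φ₁

    QFreeL : List (Formula Compounds) → Set
    QFreeL []       = ⊤
    QFreeL (ψ ∷ ψs) = QFree ψ × QFreeL ψs

  mutual
    FocusArity : ℕ → Formula Compounds → Set
    FocusArity m (A φ)      = FocusArity m φ
    FocusArity m (E φ)      = FocusArity m φ
    FocusArity m (atom p)   = ⊤
    FocusArity m (neg φ)    = FocusArity m φ
    FocusArity m (or φ φ₁)  = FocusArity m φ × FocusArity m φ₁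
    FocusArity m (focus ψs) = length ψs ≡ m × FocusArityL m ψs
    FocusArity m (X φ)      = FocusArity m φ
    FocusArity m (U φ φ₁)   = FocusArity m φ × FocusArity m φ₁

    FocusArityL : ℕ → List (Formula Compounds) → Set
    FocusArityL m []       = ⊤
    FocusArityL m (ψ ∷ ψs) = FocusArity m ψ × FocusArityL m ψs

  mutual
    Propositional : Formula Compounds → Set
    Propositional (A φ)      = Propositional φ
    Propositional (E φ)      = Propositional φ
    Propositional (atom p)   = ⊤
    Propositional (neg φ)    = Propositional φ
    Propositional (or φ φ₁)  = Propositional φ × Propositional φ₁
    Propositional (focus ψs) = PropositionalL ψs
    Propositional (X φ)      = ⊥
    Propositional (U φ φ₁)   = ⊥

    PropositionalL : List (Formula Compounds) → Set
    PropositionalL []       = ⊤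
    PropositionalL (ψ ∷ ψs) = Propositional ψ × PropositionalL ψs

  mutual
    FocusProp : Formula Compounds → Set
    FocusProp (A φ)      = FocusProp φ
    FocusProp (E φ)      = FocusProp φ
    FocusProp (atom p)   = ⊤
    FocusProp (neg φ)    = FocusProp φ
    FocusProp (or φ φ₁)  = FocusProp φ × FocusProp φ₁
    FocusProp (focus ψs) = PropositionalL ψs × FocusPropL ψs
    FocusProp (X φ)      = FocusProp φ
    FocusProp (U φ φ₁)   = FocusProp φ × FocusProp φ₁

    FocusPropL : List (Formula Compounds) → Set
    FocusPropL []       = ⊤
    FocusPropL (ψ ∷ ψs) = FocusProp ψ × FocusPropL ψs

  WellFormed : Formula Compounds → Set
  WellFormed φ = 1 ≤ length (prefixOf φ) × QFree (bodyOf φ)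
               × FocusArity (length (prefixOf φ)) (bodyOf φ)

  HyperLTL₂ : Formula Compounds → Set
  HyperLTL₂ φ = WellFormed φ × alternations (prefixOf φ) ≤ 1 × FocusProp φ

-- Γ[k..] (0-based shift: shift 0 Γ = Γ = the paper's Γ[1..])
shift : ∀ {na l} → ℕ → Vec (Comp na) l → Vec (Comp na) l
shift k Γ = map (λ γ i → γ (k + i)) Γ

firsts : ∀ {na l} → Vec (Comp na) l → Vec (Subset na) l
firsts Γ = map (λ γ → γ 0) Γ

module _ {na : ℕ} {Compounds : Set} (M : Comp na → Set) (B : Bonding na Compounds) where

  mutual
    Sat : ∀ {l} → Vec (Comp na) l → Formula Compounds → Set
    Sat Γ (A ψ)      = ∀ (γ : Comp na) → M γ → Sat (Γ ∷ʳ γ) ψ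
    Sat Γ (E ψ)      = Σ (Comp na) (λ γ → M γ × Sat (Γ ∷ʳ γ) ψ)
    Sat {l} Γ (atom p) = B l (firsts Γ) p
    Sat Γ (neg ψ)    = ¬ Sat Γ ψ
    Sat Γ (or ψ ψ₁)  = Sat Γ ψ ⊎ Sat Γ ψ₁
    Sat Γ (focus ψs) = SatFocus Γ ψs
    Sat Γ (X ψ)      = Sat (shift 1 Γ) ψ
    Sat Γ (U ψ ψ₁)   = Σ ℕ (λ k → Sat (shift k Γ) ψ₁ × (∀ j → j < k → Sat (shift j Γ) ψ))

    -- ⟨ψ₁,…,ψ_m⟩: prj_i(Γ) ⊨ ψ_i for all i ≤ m (false if prj_i(Γ) is undefined)
    SatFocus : ∀ {l} → Vec (Comp na) l → List (Formula Compounds) → Set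
    SatFocus Γ        []       = ⊤
    SatFocus []       (ψ ∷ ψs) = ⊥
    SatFocus (γ ∷ Γ)  (ψ ∷ ψs) = Sat (γ ∷ []) ψ × SatFocus Γ ψs

  Holds : Formula Compounds → Set
  Holds φ = Sat [] φ

zipC : ∀ {na n} → Vec (Comp na) n → Word (Letter na n)
zipC Γ i = map (λ γ → γ i) Γ

unzipW : ∀ {na n} → Word (Letter na n) → Vec (Comp na) n
unzipW w = tabulate (λ l i → lookup (w i) l)

ZipLang : ∀ {na} → (Comp na → Set) → (n : ℕ) → Word (Letter na n) → Set
ZipLang {na} M n w =
  Σ (Vec (Comp na) n) (λ Γ → Data.Vec.Relation.Unary.All.All M Γ × (∀ i → w i ≡ zipC Γ i))
  where import Data.Vec.Relation.Unary.All

record Buchi (Σ' : Set) : Set where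
  field
    nS : ℕ
    Δ  : List (Fin nS × Σ' × Fin nS)
    S₀ : Subset nS
    F  : Subset nS

open Buchi public

Accepts : ∀ {Σ'} → Buchi Σ' → Word Σ' → Set
Accepts 𝒜 w =
  Σ (ℕ → Fin (nS 𝒜)) λ r →
      r 0 ∈ₛ S₀ 𝒜
    × (∀ i → (r i , w i , r (suc i)) ∈ₗ Δ 𝒜)
    × (∀ i → Σ ℕ (λ j → i ≤ j × r j ∈ₛ F 𝒜))

restrict : ∀ {Σ' : Set} (k : ℕ) {j : ℕ} → Buchi (Vec Σ' (k + j)) → Buchi (Vec Σ' k)
restrict k 𝒜 = record
  { nS = nS 𝒜
  ; Δ  = L.map (λ { (s , a , t) → (s , take k a , t) }) (Δ 𝒜)
  ; S₀ = S₀ 𝒜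
  ; F  = F 𝒜 }

IsIntersection : ∀ {Σ'} → Buchi Σ' → Buchi Σ' → Buchi Σ' → Set
IsIntersection 𝒞 𝒜 ℬ = ∀ w → Accepts 𝒞 w ⇔ (Accepts 𝒜 w × Accepts ℬ w)

IsComplement : ∀ {Σ'} → Buchi Σ' → Buchi Σ' → Set
IsComplement 𝒞 𝒜 = ∀ w → Accepts 𝒞 w ⇔ (¬ Accepts 𝒜 w)

EmptyLang : ∀ {Σ'} → Buchi Σ' → Set
EmptyLang 𝒜 = ∀ w → ¬ Accepts 𝒜 w

-- Both sides say the same thing: every k-tuple Γ of paths of M extends by j
-- paths of M to a tuple satisfying ψ. On the formula side this is the meaning
-- of the prefix A^k E^j. On the automaton side, A^n_M ∩ A_ψ accepts the zips
-- of such extended tuples, so its restriction to the first k tracks accepts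
-- zip Γ exactly when Γ extends, and the emptiness of
-- ((A^n_M ∩ A_ψ)|_k)^C ∩ A^k_M says that every zip Γ with Γ ∈ M^k does; only
-- this last reformulation (¬¬-elimination) needs excluded middle.
module Submission where

open import Defs
open import Level using (0ℓ)
open import Axiom.ExcludedMiddle using (ExcludedMiddle)
open import Data.Nat using (ℕ; zero; suc; _+_)
open import Data.Fin using (Fin)
open import Data.Fin.Subset using (Subset)
open import Data.Product using (Σ; _×_; _,_; proj₁; proj₂)
open import Data.Sum using (inj₁; inj₂)
open import Data.Unit using (tt)
open import Relation.Nullary.Decidable using (decidable-stable)
open import Relation.Binary.PropositionalEquality
  using (_≡_; refl; sym; trans; cong; subst; module ≡-Reasoning)
open import Function.Definitions using (Injective)
open import Function.Bundles using (_⇔_; mk⇔; Equivalence)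
import Function.Properties.Equivalence as ⇔
open import Data.Product.Function.NonDependent.Propositional using (_×-⇔_)
open import Data.Vec using (Vec; []; _∷_; _∷ʳ_; _++_; take; lookup; splitAt)
open import Data.Vec.Properties using (tabulate-∘; tabulate∘lookup; ∷-injective)
open import Data.Vec.Relation.Unary.All using (All; []; _∷_)
import Data.Vec.Relation.Unary.All.Properties as All
import Data.List as List
open import Data.List.Membership.Propositional using (_∈_)
open import Data.List.Membership.Propositional.Properties using (∈-map⁺; ∈-map⁻)

open Equivalence using (to; from)

-- Sat only looks at the values of the computations in a tuple, but the
-- quantifier clauses build tuples such as (Γ ∷ʳ γ) ++ Δ, whose length
-- (l + 1) + m is not definitionally l + suc m; hence the two lengths.
module _ {na : ℕ} where

  infix 4 _≋_

  data _≋_ : ∀ {l l'} → Vec (Comp na) l → Vec (Comp na) l' → Set where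
    []  : [] ≋ []
    _∷_ : ∀ {l l'} {γ γ' : Comp na} {Γ : Vec (Comp na) l} {Γ' : Vec (Comp na) l'} →
          (∀ i → γ i ≡ γ' i) → Γ ≋ Γ' → γ ∷ Γ ≋ γ' ∷ Γ'

  ≋-refl : ∀ {l} (Γ : Vec (Comp na) l) → Γ ≋ Γ
  ≋-refl []      = []
  ≋-refl (γ ∷ Γ) = (λ _ → refl) ∷ ≋-refl Γ

  ≋-sym : ∀ {l l'} {Γ : Vec (Comp na) l} {Γ' : Vec (Comp na) l'} → Γ ≋ Γ' → Γ' ≋ Γ
  ≋-sym []       = []
  ≋-sym (p ∷ Γ≋) = (λ i → sym (p i)) ∷ ≋-sym Γ≋

  ≋-trans : ∀ {l l' l''} {Γ : Vec (Comp na) l} {Γ' : Vec (Comp na) l'}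
    {Γ'' : Vec (Comp na) l''} → Γ ≋ Γ' → Γ' ≋ Γ'' → Γ ≋ Γ''
  ≋-trans []       []       = []
  ≋-trans (p ∷ Γ≋) (q ∷ Γ≋') = (λ i → trans (p i) (q i)) ∷ ≋-trans Γ≋ Γ≋'

  ≋-∷ʳ : ∀ {l l'} {Γ : Vec (Comp na) l} {Γ' : Vec (Comp na) l'} (γ : Comp na) →
    Γ ≋ Γ' → Γ ∷ʳ γ ≋ Γ' ∷ʳ γ
  ≋-∷ʳ γ []       = (λ _ → refl) ∷ []
  ≋-∷ʳ γ (p ∷ Γ≋) = p ∷ ≋-∷ʳ γ Γ≋

  ≋-++ : ∀ {l l' m m'} {Γ : Vec (Comp na) l} {Γ' : Vec (Comp na) l'}
    {Δ : Vec (Comp na) m} {Δ' : Vec (Comp na) m'} →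
    Γ ≋ Γ' → Δ ≋ Δ' → Γ ++ Δ ≋ Γ' ++ Δ'
  ≋-++ []       Δ≋ = Δ≋
  ≋-++ (p ∷ Γ≋) Δ≋ = p ∷ ≋-++ Γ≋ Δ≋

  ≋-shift : ∀ {l l'} {Γ : Vec (Comp na) l} {Γ' : Vec (Comp na) l'} (k : ℕ) →
    Γ ≋ Γ' → shift k Γ ≋ shift k Γ'
  ≋-shift k []       = []
  ≋-shift k (p ∷ Γ≋) = (λ i → p (k + i)) ∷ ≋-shift k Γ≋

  ≋-firsts : ∀ {l l'} {Γ : Vec (Comp na) l} {Γ' : Vec (Comp na) l'} →
    Γ ≋ Γ' → (P : ∀ m → Vec (Subset na) m → Set) → P l (firsts Γ) → P l' (firsts Γ')
  ≋-firsts [] P x = x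
  ≋-firsts {Γ = γ ∷ Γ} {Γ' = γ' ∷ _} (p ∷ Γ≋) P x =
    ≋-firsts Γ≋ (λ m v → P (suc m) (γ' 0 ∷ v)) (subst (λ a → P _ (a ∷ firsts Γ)) (p 0) x)

  ++-identityʳ-≋ : ∀ {l} (Γ : Vec (Comp na) l) → Γ ++ [] ≋ Γ
  ++-identityʳ-≋ []      = []
  ++-identityʳ-≋ (γ ∷ Γ) = (λ _ → refl) ∷ ++-identityʳ-≋ Γ

  ∷ʳ-++-≋ : ∀ {l m} (Γ : Vec (Comp na) l) (γ : Comp na) (Δ : Vec (Comp na) m) →
    (Γ ∷ʳ γ) ++ Δ ≋ Γ ++ (γ ∷ Δ)
  ∷ʳ-++-≋ []      γ Δ = ≋-refl (γ ∷ Δ)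
  ∷ʳ-++-≋ (x ∷ Γ) γ Δ = (λ _ → refl) ∷ ∷ʳ-++-≋ Γ γ Δ

  zipC-injective : ∀ {l} (Γ Γ' : Vec (Comp na) l) → (∀ i → zipC Γ i ≡ zipC Γ' i) → Γ ≋ Γ'
  zipC-injective []      []        _  = []
  zipC-injective (γ ∷ Γ) (γ' ∷ Γ') eq =
    (λ i → proj₁ (∷-injective (eq i))) ∷ zipC-injective Γ Γ' (λ i → proj₂ (∷-injective (eq i)))

  zipC-unzipW : ∀ {n} (w : Word (Letter na n)) i → zipC (unzipW w) i ≡ w i
  zipC-unzipW w i = trans (sym (tabulate-∘ (λ γ → γ i) (λ l i → lookup (w i) l)))
                          (tabulate∘lookup (w i))

  unzipW-≋ : ∀ {n} (w : Word (Letter na n)) (Γ : Vec (Comp na) n) →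
    (∀ i → w i ≡ zipC Γ i) → unzipW w ≋ Γ
  unzipW-≋ w Γ eq = zipC-injective (unzipW w) Γ (λ i → trans (zipC-unzipW w i) (eq i))

  take-zipC-++ : ∀ {k j} (Γ : Vec (Comp na) k) (Δ : Vec (Comp na) j) i →
    take k (zipC (Γ ++ Δ) i) ≡ zipC Γ i
  take-zipC-++ []      Δ i = refl
  take-zipC-++ (γ ∷ Γ) Δ i = cong (γ i ∷_) (take-zipC-++ Γ Δ i)

module _ {na : ℕ} {Compounds : Set} (M : Comp na → Set) (B : Bonding na Compounds) where

  mutual
    Sat-≋ : ∀ {l l'} {Γ : Vec (Comp na) l} {Γ' : Vec (Comp na) l'} → Γ ≋ Γ' →
      (φ : Formula Compounds) → Sat M B Γ φ → Sat M B Γ' φ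
    Sat-≋ Γ≋ (A φ)      s γ m          = Sat-≋ (≋-∷ʳ γ Γ≋) φ (s γ m)
    Sat-≋ Γ≋ (E φ)      (γ , m , s)    = γ , m , Sat-≋ (≋-∷ʳ γ Γ≋) φ s
    Sat-≋ Γ≋ (atom p)   s              = ≋-firsts Γ≋ (λ m v → B m v p) s
    Sat-≋ Γ≋ (neg φ)    ¬s s'          = ¬s (Sat-≋ (≋-sym Γ≋) φ s')
    Sat-≋ Γ≋ (or φ φ')  (inj₁ s)       = inj₁ (Sat-≋ Γ≋ φ s)
    Sat-≋ Γ≋ (or φ φ')  (inj₂ s)       = inj₂ (Sat-≋ Γ≋ φ' s)
    Sat-≋ Γ≋ (focus ψs) s              = SatFocus-≋ Γ≋ ψs s
    Sat-≋ Γ≋ (X φ)      s              = Sat-≋ (≋-shift 1 Γ≋) φ s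
    Sat-≋ Γ≋ (U φ φ')   (k , s , s<k)  =
      k , Sat-≋ (≋-shift k Γ≋) φ' s , λ i i<k → Sat-≋ (≋-shift i Γ≋) φ (s<k i i<k)

    SatFocus-≋ : ∀ {l l'} {Γ : Vec (Comp na) l} {Γ' : Vec (Comp na) l'} → Γ ≋ Γ' →
      (ψs : List.List (Formula Compounds)) → SatFocus M B Γ ψs → SatFocus M B Γ' ψs
    SatFocus-≋ Γ≋       List.[]        s       = tt
    SatFocus-≋ []       (ψ List.∷ ψs)  ()
    SatFocus-≋ (p ∷ Γ≋) (ψ List.∷ ψs)  (s , t) = Sat-≋ (p ∷ []) ψ s , SatFocus-≋ Γ≋ ψs t

  Sat-Ablock : ∀ {l} (Γ : Vec (Comp na) l) k φ →
    Sat M B Γ (Ablock k φ) ⇔ (∀ (Δ : Vec (Comp na) k) → All M Δ → Sat M B (Γ ++ Δ) φ)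
  Sat-Ablock Γ zero φ = mk⇔
    (λ { s [] [] → Sat-≋ (≋-sym (++-identityʳ-≋ Γ)) φ s })
    (λ s → Sat-≋ (++-identityʳ-≋ Γ) φ (s [] []))
  Sat-Ablock Γ (suc k) φ = mk⇔
    (λ { s (γ ∷ Δ) (m ∷ ms) → Sat-≋ (∷ʳ-++-≋ Γ γ Δ) φ (to (IH γ) (s γ m) Δ ms) })
    (λ s γ m → from (IH γ) (λ Δ ms → Sat-≋ (≋-sym (∷ʳ-++-≋ Γ γ Δ)) φ (s (γ ∷ Δ) (m ∷ ms))))
    where IH = λ γ → Sat-Ablock (Γ ∷ʳ γ) k φ

  Extends : ∀ {l} (j : ℕ) → Formula Compounds → Vec (Comp na) l → Set
  Extends j φ Γ = Σ (Vec (Comp na) j) λ Δ → All M Δ × Sat M B (Γ ++ Δ) φ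

  Sat-Eblock : ∀ {l} (Γ : Vec (Comp na) l) j φ → Sat M B Γ (Eblock j φ) ⇔ Extends j φ Γ
  Sat-Eblock Γ zero φ = mk⇔
    (λ s → [] , [] , Sat-≋ (≋-sym (++-identityʳ-≋ Γ)) φ s)
    (λ { ([] , [] , s) → Sat-≋ (++-identityʳ-≋ Γ) φ s })
  Sat-Eblock Γ (suc j) φ = mk⇔
    (λ { (γ , m , s) → let Δ , ms , s' = to (IH γ) s in
           γ ∷ Δ , m ∷ ms , Sat-≋ (∷ʳ-++-≋ Γ γ Δ) φ s' })
    (λ { (γ ∷ Δ , m ∷ ms , s) → γ , m , from (IH γ) (Δ , ms , Sat-≋ (≋-sym (∷ʳ-++-≋ Γ γ Δ)) φ s) })
    where IH = λ γ → Sat-Eblock (Γ ∷ʳ γ) j φ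

  Holds-AE : ∀ k j φ →
    Holds M B (AE k j φ) ⇔ (∀ (Γ : Vec (Comp na) k) → All M Γ → Extends j φ Γ)
  Holds-AE k j φ = ⇔.trans (Sat-Ablock [] k (Eblock j φ))
    (mk⇔ (λ h Γ ms → to (Sat-Eblock Γ j φ) (h Γ ms)) (λ h Γ ms → from (Sat-Eblock Γ j φ) (h Γ ms)))

Accepts-cong : ∀ {Σ'} (𝒜 : Buchi Σ') {w w' : Word Σ'} → (∀ i → w i ≡ w' i) →
  Accepts 𝒜 w → Accepts 𝒜 w'
Accepts-cong 𝒜 w≡w' (r , r₀ , step , fair) =
  r , r₀ , (λ i → subst (λ a → (r i , a , r (suc i)) ∈ Δ 𝒜) (w≡w' i) (step i)) , fair

Accepts-restrict : ∀ {Σ'} k {j} (𝒜 : Buchi (Vec Σ' (k + j))) (w : Word (Vec Σ' k)) →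
  Accepts (restrict k {j} 𝒜) w
    ⇔ Σ (Word (Vec Σ' (k + j))) λ w' → (∀ i → take k (w' i) ≡ w i) × Accepts 𝒜 w'
Accepts-restrict {Σ'} k {j} 𝒜 w = mk⇔ unrestrict (λ (w' , take≡ , acc) → restrict-run w' take≡ acc)
  where
    restrictLabel : Fin (nS 𝒜) × Vec Σ' (k + j) × Fin (nS 𝒜) → Fin (nS 𝒜) × Vec Σ' k × Fin (nS 𝒜)
    restrictLabel (s , b , t) = s , take k b , t

    lift : ∀ {s a t} → (s , a , t) ∈ Δ (restrict k {j} 𝒜) →
      Σ (Vec Σ' (k + j)) λ b → take k b ≡ a × (s , b , t) ∈ Δ 𝒜
    lift st with ∈-map⁻ restrictLabel st
    ... | (_ , b , _) , st' , refl = b , refl , st'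

    unrestrict : Accepts (restrict k {j} 𝒜) w →
      Σ (Word (Vec Σ' (k + j))) λ w' → (∀ i → take k (w' i) ≡ w i) × Accepts 𝒜 w'
    unrestrict (r , r₀ , step , fair) =
      (λ i → proj₁ (lift (step i))) , (λ i → proj₁ (proj₂ (lift (step i)))) ,
      r , r₀ , (λ i → proj₂ (proj₂ (lift (step i)))) , fair

    restrict-run : ∀ w' → (∀ i → take k (w' i) ≡ w i) → Accepts 𝒜 w' →
      Accepts (restrict k {j} 𝒜) w
    restrict-run w' take≡ (r , r₀ , step , fair) = Accepts-cong (restrict k {j} 𝒜) take≡
      (r , r₀ , (λ i → ∈-map⁺ restrictLabel (step i)) , fair)

EmptyLang-∁∩⇔⊆ : ∀ {Σ'} → ExcludedMiddle 0ℓ → {𝒜 𝒞 𝒦 ℱ : Buchi Σ'} →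
  IsComplement 𝒞 𝒜 → IsIntersection ℱ 𝒞 𝒦 →
  EmptyLang ℱ ⇔ (∀ w → Accepts 𝒦 w → Accepts 𝒜 w)
EmptyLang-∁∩⇔⊆ em 𝒞≡ ℱ≡ = mk⇔
  (λ empty w kw → decidable-stable em (λ ¬aw → empty w (from (ℱ≡ w) (from (𝒞≡ w) ¬aw , kw))))
  (λ ⊆ w fw → let cw , kw = to (ℱ≡ w) fw in to (𝒞≡ w) cw (⊆ w kw))

module _ {na : ℕ} {M : Comp na → Set} where

  ⊆-ZipLang⇔ : ∀ {k} {𝒦 : Buchi (Letter na k)} → (∀ w → Accepts 𝒦 w ⇔ ZipLang M k w) →
    (𝒜 : Buchi (Letter na k)) →
    (∀ w → Accepts 𝒦 w → Accepts 𝒜 w) ⇔ (∀ (Γ : Vec (Comp na) k) → All M Γ → Accepts 𝒜 (zipC Γ))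
  ⊆-ZipLang⇔ 𝒦≡ 𝒜 = mk⇔
    (λ ⊆ Γ ms → ⊆ (zipC Γ) (from (𝒦≡ (zipC Γ)) (Γ , ms , λ _ → refl)))
    (λ accepts w kw → let Γ , ms , w≡ = to (𝒦≡ w) kw in
                      Accepts-cong 𝒜 (λ i → sym (w≡ i)) (accepts Γ ms))

  Accepts-restrict-zipC : ∀ {Compounds : Set} (B : Bonding na Compounds) k j ψ →
    (𝒜 : Buchi (Letter na (k + j))) →
    (∀ w → Accepts 𝒜 w ⇔ (ZipLang M (k + j) w × Sat M B (unzipW w) ψ)) →
    (Γ : Vec (Comp na) k) → All M Γ → Accepts (restrict k {j} 𝒜) (zipC Γ) ⇔ Extends M B j ψ Γ
  Accepts-restrict-zipC B k j ψ 𝒜 𝒜≡ Γ ms = mk⇔ extends accepts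
    where
      extends : Accepts (restrict k {j} 𝒜) (zipC Γ) → Extends M B j ψ Γ
      extends r with to (Accepts-restrict k 𝒜 (zipC Γ)) r
      ... | w' , take≡ , acc with to (𝒜≡ w') acc
      ... | (Γ' , ms' , w'≡) , s with splitAt k Γ'
      ... | Γ₁ , Δ , refl =
        Δ , proj₂ (All.++⁻ Γ₁ ms') ,
        Sat-≋ M B (≋-trans (unzipW-≋ w' (Γ₁ ++ Δ) w'≡) (≋-++ Γ₁≋Γ (≋-refl Δ))) ψ s
        where
          open ≡-Reasoning
          Γ₁≋Γ : Γ₁ ≋ Γ
          Γ₁≋Γ = zipC-injective Γ₁ Γ λ i → begin
            zipC Γ₁ i                  ≡⟨ take-zipC-++ Γ₁ Δ i ⟨
            take k (zipC (Γ₁ ++ Δ) i)  ≡⟨ cong (take k) (w'≡ i) ⟨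
            take k (w' i)              ≡⟨ take≡ i ⟩
            zipC Γ i                   ∎

      accepts : Extends M B j ψ Γ → Accepts (restrict k {j} 𝒜) (zipC Γ)
      accepts (Δ , ms' , s) = from (Accepts-restrict k 𝒜 (zipC Γ))
        ( zipC (Γ ++ Δ) , take-zipC-++ Γ Δ
        , from (𝒜≡ (zipC (Γ ++ Δ)))
            ( (Γ ++ Δ , All.++⁺ ms ms' , λ _ → refl)
            , Sat-≋ M B (≋-sym (unzipW-≋ _ (Γ ++ Δ) (λ _ → refl))) ψ s))

theorem1 : ExcludedMiddle 0ℓ →
    (na : ℕ) (Compounds : Set) (ι : Fin na → Compounds) → Injective _≡_ _≡_ ι →
    (B : Bonding na Compounds) → B₁-identity ι B →
    (M : Comp na → Set) →
    Σ (Buchi (Subset na)) (λ 𝒜 → ∀ γ → Accepts 𝒜 γ ⇔ M γ) →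
    (k j : ℕ) (ψ : Formula Compounds) → QFree ψ → HyperLTL₂ (AE k j ψ) →
    (AnM : Buchi (Letter na (k + j))) → (∀ w → Accepts AnM w ⇔ ZipLang M (k + j) w) →
    (AkM : Buchi (Letter na k)) → (∀ w → Accepts AkM w ⇔ ZipLang M k w) →
    (Aψ : Buchi (Letter na (k + j))) → (∀ w → Accepts Aψ w ⇔ Sat M B (unzipW w) ψ) →
    (Aint : Buchi (Letter na (k + j))) → IsIntersection Aint AnM Aψ →
    (Acomp : Buchi (Letter na k)) → IsComplement Acomp (restrict k {j} Aint) →
    (Afin : Buchi (Letter na k)) → IsIntersection Afin Acomp AkM →
    Holds M B (AE k j ψ) ⇔ EmptyLang Afin
theorem1 em na _ _ _ B _ M _ k j ψ _ _ _ AnM≡ _ AkM≡ _ Aψ≡ Aint Aint≡ _ Acomp≡ _ Afin≡ =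
  ⇔.trans (Holds-AE M B k j ψ)
  (⇔.trans (mk⇔ (λ h Γ ms → from (restricted Γ ms) (h Γ ms)) (λ h Γ ms → to (restricted Γ ms) (h Γ ms)))
  (⇔.trans (⇔.sym (⊆-ZipLang⇔ AkM≡ (restrict k Aint)))
           (⇔.sym (EmptyLang-∁∩⇔⊆ em Acomp≡ Afin≡))))
  where
    restricted : (Γ : Vec (Comp na) k) → All M Γ →
      Accepts (restrict k {j} Aint) (zipC Γ) ⇔ Extends M B j ψ Γ
    restricted = Accepts-restrict-zipC B k j ψ Aint (λ w → ⇔.trans (Aint≡ w) (AnM≡ w ×-⇔ Aψ≡ w))
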